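{- Let $G$ be a finite graph and $L$ a list-assignment for $G$. If there exists an ordering of $V(G)$ in which each vertex $x$ is preceded by fewer than $|L(x)|$ of its neighbors, then $G$ is $L$-swappable. In particular, $G$ is $L$-swappable when $G$ is $(k-1)$-degenerate and $L$ is a $k$-assignment; this includes the special case $k=\Delta(G)$ with $G$ connected but not regular.
   Context: A list-assignment $L$ assigns to each vertex $v$ a set $L(v)$ of colors; a $k$-assignment has $|L(v)|=k$ for all $v$. An $L$-coloring is a proper coloring $\varphi$ with $\varphi(v)\in L(v)$. An $\alpha,\beta$-Kempe swap at a vertex $u$ with $\varphi(u)\in\{\alpha,\beta\}$ interchanges $\alpha$ and $\beta$ on the component containing $u$ of the subgraph induced by vertices colored $\alpha$ or $\beta$; it is $L$-valid if the result is again an $L$-coloring. Two $L$-colorings are $L$-equivalent if one is obtained from the other by a sequence of $L$-valid Kempe swaps. $G$ is $L$-swappable if it has at least one $L$-coloring and all its $L$-colorings are pairwise $L$-equivalent. $\Delta(G)$ is the maximum degree. -}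

module Defs where

open import Data.Nat using (ℕ; _≤_; _<_; _≟_)
open import Data.Fin using (Fin) renaming (_<_ to _<ᶠ_; _<?_ to _<ᶠ?_)
open import Data.Fin.Properties using (all?)
open import Data.Bool using (Bool; true; false; T; if_then_else_)
open import Data.Bool.Properties using (T?)
open import Data.List using (List; length; filter)
open import Data.List.Base using (allFin)
open import Data.List.Membership.Propositional using (_∈_)
open import Data.List.Relation.Unary.Unique.Propositional using (Unique)
open import Data.Product using (Σ; ∃; ∃-syntax; _×_; _,_)
open import Data.Sum using (_⊎_)
open import Relation.Nullary using (¬_; does)
open import Relation.Nullary.Decidable using (_×-dec_)
open import Relation.Binary.PropositionalEquality using (_≡_; _≢_; _≗_)
open import Relation.Binary.Construct.Closure.ReflexiveTransitive using (Star)
open import Function.Definitions using (Injective)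

record Graph : Set where
  field
    n     : ℕ
    adj   : Fin n → Fin n → Bool
    sym   : ∀ u v → adj u v ≡ adj v u
    irrefl : ∀ v → adj v v ≡ false

open Graph public

Vertex : Graph → Set
Vertex G = Fin (n G)

-- Colors are natural numbers; a list-assignment gives each vertex a finite
-- set of colors, represented as a duplicate-free list.
record ListAssignment (G : Graph) : Set where
  field
    lists  : Vertex G → List ℕ
    unique : ∀ v → Unique (lists v)

open ListAssignment public

size : {G : Graph} → ListAssignment G → Vertex G → ℕ
size L v = length (lists L v)

IsKAssignment : {G : Graph} → ℕ → ListAssignment G → Set
IsKAssignment {G} k L = ∀ (v : Vertex G) → size L v ≡ k

Coloring : Graph → Set
Coloring G = Vertex G → ℕ

IsLColoring : {G : Graph} → ListAssignment G → Coloring G → Set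
IsLColoring {G} L φ =
  (∀ v → φ v ∈ lists L v) ×
  (∀ u v → adj G u v ≡ true → φ u ≢ φ v)

ColoredIn : {G : Graph} → Coloring G → ℕ → ℕ → Vertex G → Set
ColoredIn φ α β v = (φ v ≡ α) ⊎ (φ v ≡ β)

-- Reach φ α β u v: v lies in the component containing u of the subgraph
-- induced by the vertices colored α or β.
data Reach {G : Graph} (φ : Coloring G) (α β : ℕ) (u : Vertex G) : Vertex G → Set where
  here : ColoredIn {G} φ α β u → Reach φ α β u u
  step : ∀ {v w : Vertex G} → Reach {G} φ α β u v → adj G v w ≡ true → ColoredIn {G} φ α β w →
         Reach φ α β u w

swapColor : ℕ → ℕ → ℕ → ℕ
swapColor α β c = if does (c ≟ α) then β else (if does (c ≟ β) then α else c)

KempeSwapAt : {G : Graph} → ℕ → ℕ → Vertex G → Coloring G → Coloring G → Set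
KempeSwapAt {G} α β u φ ψ =
  ColoredIn {G} φ α β u ×
  (∀ v → (Reach {G} φ α β u v → ψ v ≡ swapColor α β (φ v)) ×
         (¬ Reach {G} φ α β u v → ψ v ≡ φ v))

LValidSwap : {G : Graph} → ListAssignment G → Coloring G → Coloring G → Set
LValidSwap {G} L φ ψ =
  (∃[ α ] ∃[ β ] Σ (Vertex G) λ u → KempeSwapAt {G} α β u φ ψ) × IsLColoring L ψ

-- L-equivalence: a finite sequence of L-valid Kempe swaps (colorings are
-- compared pointwise at the end).
LEquivalent : {G : Graph} → ListAssignment G → Coloring G → Coloring G → Set
LEquivalent {G} L φ ψ = Σ (Coloring G) λ χ → (Star (LValidSwap L) φ χ × (χ ≗ ψ))

LSwappable : (G : Graph) → ListAssignment G → Set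
LSwappable G L =
  (Σ (Coloring G) λ φ → IsLColoring L φ) ×
  (∀ (φ ψ : Coloring G) → IsLColoring L φ → IsLColoring L ψ → LEquivalent L φ ψ)

-- An ordering of V(G): an injective (hence bijective) position map.
record Ordering (G : Graph) : Set where
  field
    pos : Vertex G → Fin (n G)
    pos-injective : Injective _≡_ _≡_ pos

open Ordering public

precedingNbrs : {G : Graph} → Ordering G → Vertex G → ℕ
precedingNbrs {G} σ x =
  length (filter (λ y → T? (adj G x y) ×-dec (pos σ y <ᶠ? pos σ x)) (allFin (n G)))

degree : (G : Graph) → Vertex G → ℕ
degree G v = length (filter (λ y → T? (adj G v y)) (allFin (n G)))

degreeIn : (G : Graph) → (Vertex G → Bool) → Vertex G → ℕ
degreeIn G S v = length (filter (λ y → T? (S y) ×-dec T? (adj G v y)) (allFin (n G)))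

-- G is d-degenerate: every nonempty subgraph has a vertex of degree ≤ d
-- (it suffices to quantify over induced subgraphs).
Degenerate : ℕ → Graph → Set
Degenerate d G =
  ∀ (S : Vertex G → Bool) → (∃[ v ] T (S v)) →
  ∃[ v ] (T (S v) × degreeIn G S v ≤ d)

IsMaxDegree : (G : Graph) → ℕ → Set
IsMaxDegree G Δ = (∀ v → degree G v ≤ Δ) × (∃[ v ] degree G v ≡ Δ)

data Path (G : Graph) (u : Vertex G) : Vertex G → Set where
  here : Path G u u
  step : ∀ {v w} → Path G u v → adj G v w ≡ true → Path G u w

Connected : Graph → Set
Connected G = ∀ u v → Path G u v

Regular : Graph → Set
Regular G = ∀ u v → degree G u ≡ degree G v

{-# OPTIONS --safe #-}
module Submission where

-- Induct on the vertex set, using the form of the hypothesis "every nonempty set of vertices has a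
-- vertex with fewer neighbours inside the set than colors in its list" (the ordering read backwards;
-- the degeneracy hypotheses give it directly). Delete such a vertex v. Every L-valid α,β-Kempe swap
-- of G - v lifts to at most two L-valid swaps of G agreeing with it off v: if some color of L(v)
-- other than α, β is unused around v, recolor v with it, so that v lies in no α,β-chain; otherwise
-- counting the colors of L(v) against the fewer neighbours of v shows that v carries α or β, that at
-- most one neighbour carries the other color, and that this color is in L(v), so v merges no two
-- α,β-components and can be swapped along with its own. Lifting the swaps that connect the
-- restrictions of two L-colorings and recoloring v at the end connects the colorings themselves.

open import Data.Nat using (ℕ; zero; suc; _+_; _≤_; _<_; z≤n; s≤s; _<?_) renaming (_≟_ to _≟ℕ_)
open import Data.Nat.Induction using (<-wellFounded)
open import Data.Nat.Properties
  using (+-suc; +-cancelʳ-<; +-monoʳ-≤; m≤m+n; ≤-trans; ≤-<-trans; <-≤-trans; ≤-antisym; ≤-pred; ≮⇒≥;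
         ≤∧≢⇒<; n≤0⇒n≡0; n≮n)
open import Data.Fin using (Fin; toℕ) renaming (_≟_ to _≟ᶠ_; _<_ to _<ᶠ_; _<?_ to _<ᶠ?_)
open import Data.Fin.Properties using (any?; toℕ<n; toℕ-injective)
open import Data.Bool using (Bool; true; T; _∧_; not)
open import Data.Bool.Properties using (T?; T-≡) renaming (_≟_ to _≟ᵇ_)
open import Data.Unit using (tt)
open import Data.Empty using (⊥; ⊥-elim)
open import Data.Product using (Σ; ∃; ∃-syntax; _×_; _,_; proj₁; proj₂)
open import Data.Sum using (_⊎_; inj₁; inj₂; [_,_])
open import Data.List using (List; []; _∷_; length; _++_; map; filter; allFin)
open import Data.List.Properties using (length-++; length-map)
open import Data.List.Membership.Propositional using (_∈_; _∉_; find; lose)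
open import Data.List.Membership.DecPropositional _≟ℕ_ using (_∈?_)
open import Data.List.Membership.Propositional.Properties
  using (∈-∃++; ∈-++⁻; ∈-++⁺ˡ; ∈-++⁺ʳ; ∈-filter⁺; ∈-filter⁻; ∈-allFin; ∈-map⁺)
open import Data.List.Relation.Unary.Unique.Propositional.Properties using (filter⁺; allFin⁺; ++⁺)
open import Data.List.Relation.Binary.Disjoint.Propositional using (Disjoint)
open import Data.List.Relation.Binary.Subset.Propositional using (_⊆_)
open import Data.List.Relation.Unary.All as All using (All)
open import Data.List.Relation.Unary.AllPairs using ([]; _∷_)
open import Data.List.Relation.Unary.Any as Any using (here; there)
open import Data.List.Relation.Unary.Unique.Propositional using (Unique)
open import Data.Vec.Functional using (updateAt)
open import Data.Vec.Functional.Properties using (updateAt-updates; updateAt-minimal)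
open import Function using (const; id; _∘_)
open import Function.Bundles using (Equivalence)
open import Relation.Nullary using (¬_; ¬?; Dec; yes; no; does)
open import Relation.Nullary.Decidable
  using (dec-true; dec-false; ¬¬-excluded-middle; decidable-stable; _⊎-dec_; _×-dec_)
open import Induction.WellFounded using (Acc; acc)
open import Relation.Unary using (Decidable)
open import Relation.Binary.PropositionalEquality using (_≡_; _≢_; refl; sym; trans; cong; subst)
open import Relation.Binary.Construct.Closure.ReflexiveTransitive as Star using (Star; ε; _◅_; _◅◅_)

open import Defs hiding (sym)

Unique-⊆⇒length≤ : ∀ {A : Set} {xs ys : List A} → Unique xs → xs ⊆ ys → length xs ≤ length ys
Unique-⊆⇒length≤ {xs = []} _ _ = z≤n
Unique-⊆⇒length≤ {xs = x ∷ xs} (x∉xs ∷ xs!) xs⊆ys with ∈-∃++ (xs⊆ys (here refl))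
... | p , q , refl = subst (suc (length xs) ≤_) (sym length-split)
                       (s≤s (subst (length xs ≤_) (length-++ p) (Unique-⊆⇒length≤ xs! xs⊆p++q)))
  where
  length-split : length (p ++ x ∷ q) ≡ suc (length p + length q)
  length-split = trans (length-++ p) (+-suc (length p) (length q))
  xs⊆p++q : xs ⊆ p ++ q
  xs⊆p++q y∈xs with ∈-++⁻ p (xs⊆ys (there y∈xs))
  ... | inj₁ y∈p = ∈-++⁺ˡ y∈p
  ... | inj₂ (here refl) = ⊥-elim (All.lookup x∉xs y∈xs refl)
  ... | inj₂ (there y∈q) = ∈-++⁺ʳ p y∈q

∈-filter-allFin⁺ : ∀ {n} {P : Fin n → Set} (P? : Decidable P) {i} → P i → i ∈ filter P? (allFin n)
∈-filter-allFin⁺ P? = ∈-filter⁺ P? (∈-allFin _)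

∈-filter-allFin⁻ : ∀ {n} {P : Fin n → Set} (P? : Decidable P) {i} → i ∈ filter P? (allFin n) → P i
∈-filter-allFin⁻ {n} P? = proj₂ ∘ ∈-filter⁻ P? {xs = allFin n}

maximum-exists : ∀ {n m} {P : Fin n → Set} → Decidable P → (f : Fin n → Fin m) → ∃ P →
                 ∃[ x ] (P x × ∀ y → P y → toℕ (f y) ≤ toℕ (f x))
maximum-exists {m = m} {P} P? f (x₀ , px₀) = climb m x₀ px₀ (m≤m+n m _)
  where
  climb : ∀ k x → P x → m ≤ k + toℕ (f x) → ∃[ x ] (P x × ∀ y → P y → toℕ (f y) ≤ toℕ (f x))
  climb k x px bound with any? (λ y → P? y ×-dec (f x <ᶠ? f y))
  ... | no noneAbove = x , px , λ y py → ≮⇒≥ λ fx<fy → noneAbove (y , py , fx<fy)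
  climb zero x px bound | yes _ = ⊥-elim (n≮n m (≤-<-trans bound (toℕ<n (f x))))
  climb (suc k) x px bound | yes (y , py , fx<fy) =
    climb k y py (≤-trans bound (subst (_≤ k + toℕ (f y)) (+-suc k (toℕ (f x))) (+-monoʳ-≤ k fx<fy)))

swapColor-α : ∀ α β → swapColor α β α ≡ β
swapColor-α α β rewrite dec-true (α ≟ℕ α) refl = refl

swapColor-β : ∀ α β → swapColor α β β ≡ α
swapColor-β α β with β ≟ℕ α
... | yes refl = swapColor-α β β
... | no β≢α rewrite dec-false (β ≟ℕ α) β≢α | dec-true (β ≟ℕ β) refl = refl

swapColor-other : ∀ α β {c} → c ≢ α → c ≢ β → swapColor α β c ≡ c
swapColor-other α β {c} c≢α c≢β rewrite dec-false (c ≟ℕ α) c≢α | dec-false (c ≟ℕ β) c≢β = refl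

swapColor-involutive : ∀ α β c → swapColor α β (swapColor α β c) ≡ c
swapColor-involutive α β c with c ≟ℕ α
... | yes refl = trans (cong (swapColor c β) (swapColor-α c β)) (swapColor-β c β)
... | no c≢α with c ≟ℕ β
...   | yes refl = trans (cong (swapColor α c) (swapColor-β α c)) (swapColor-α α c)
...   | no c≢β = trans (cong (swapColor α β) fixed) fixed
  where
  fixed : swapColor α β c ≡ c
  fixed = swapColor-other α β c≢α c≢β

swapColor-injective : ∀ α β {a b} → swapColor α β a ≡ swapColor α β b → a ≡ b
swapColor-injective α β {a} {b} eq =
  trans (sym (swapColor-involutive α β a)) (trans (cong (swapColor α β) eq) (swapColor-involutive α β b))

swapColor-idem : ∀ α c → swapColor α α c ≡ c
swapColor-idem α c with c ≟ℕ α
... | yes refl = swapColor-α c c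
... | no c≢α = swapColor-other α α c≢α c≢α

swapColor-≢ : ∀ {α β c} → α ≢ β → (c ≡ α) ⊎ (c ≡ β) → swapColor α β c ≢ c
swapColor-≢ {α} {β} α≢β (inj₁ refl) eq = α≢β (trans (sym eq) (swapColor-α α β))
swapColor-≢ {α} {β} α≢β (inj₂ refl) eq = α≢β (trans (sym (swapColor-β α β)) eq)

swapColor-stays : ∀ {α β c} → (c ≡ α) ⊎ (c ≡ β) → (swapColor α β c ≡ α) ⊎ (swapColor α β c ≡ β)
swapColor-stays {α} {β} (inj₁ refl) = inj₂ (swapColor-α α β)
swapColor-stays {α} {β} (inj₂ refl) = inj₁ (swapColor-β α β)

module Subgraphs (G : Graph) where

  VertexSet : Set
  VertexSet = Vertex G → Bool

  _⊆ᵛ_ : VertexSet → VertexSet → Set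
  S' ⊆ᵛ S = ∀ w → T (S' w) → T (S w)

  adj-irrefl : ∀ {v} → adj G v v ≢ true
  adj-irrefl {v} e with trans (sym (irrefl G v)) e
  ... | ()

  adj-sym : ∀ {u v} → adj G u v ≡ true → adj G v u ≡ true
  adj-sym {u} {v} = trans (Graph.sym G v u)

  _─_ : VertexSet → Vertex G → VertexSet
  (S ─ v) w = S w ∧ not (does (w ≟ᶠ v))

  ─-⊆ : ∀ S v → (S ─ v) ⊆ᵛ S
  ─-⊆ S v w s with S w
  ... | true = tt

  ─-≢ : ∀ S {v w} → T ((S ─ v) w) → w ≢ v
  ─-≢ S {v} {w} s with S w | w ≟ᶠ v
  ... | true | no w≢v = w≢v

  ─-intro : ∀ S {v w} → T (S w) → w ≢ v → T ((S ─ v) w)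
  ─-intro S {v} {w} s w≢v with S w | w ≟ᶠ v
  ... | true | yes w≡v = w≢v w≡v
  ... | true | no _ = tt

  members : VertexSet → List (Vertex G)
  members S = filter (λ w → T? (S w)) (allFin (n G))

  ─-members< : ∀ {S v} → T (S v) → length (members (S ─ v)) < length (members S)
  ─-members< {S} {v} sv = Unique-⊆⇒length≤ (v∉ ∷ filter⁺ _ (allFin⁺ (n G))) ⊆members
    where
    v∉ : All (v ≢_) (members (S ─ v))
    v∉ = All.tabulate λ w∈ v≡w → ─-≢ S (∈-filter-allFin⁻ (λ w → T? ((S ─ v) w)) w∈) (sym v≡w)
    ⊆members : v ∷ members (S ─ v) ⊆ members S
    ⊆members (here refl) = ∈-filter-allFin⁺ (λ w → T? (S w)) sv
    ⊆members {w} (there w∈) =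
      ∈-filter-allFin⁺ (λ w → T? (S w)) (─-⊆ S v w (∈-filter-allFin⁻ (λ w → T? ((S ─ v) w)) w∈))

  Path-exit : ∀ {S : VertexSet} {w y} → Path G w y → T (S w) → ¬ T (S y) →
              ∃[ a ] ∃[ b ] (T (S a) × ¬ T (S b) × adj G a b ≡ true)
  Path-exit here sw ¬sy = ⊥-elim (¬sy sw)
  Path-exit {S} {y = y} (step {x} p xy) sw ¬sy with T? (S x)
  ... | yes sx = x , y , sx , ¬sy , xy
  ... | no ¬sx = Path-exit p sw ¬sx

  degreeIn≤degree : ∀ S v → degreeIn G S v ≤ degree G v
  degreeIn≤degree S v =
    Unique-⊆⇒length≤ (filter⁺ (λ y → T? (S y) ×-dec T? (adj G v y)) (allFin⁺ (n G))) λ {y} y∈ →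
    ∈-filter-allFin⁺ (λ y → T? (adj G v y))
      (proj₂ (∈-filter-allFin⁻ (λ y → T? (S y) ×-dec T? (adj G v y)) y∈))

  degreeIn<degree : ∀ S {a b} → ¬ T (S b) → adj G a b ≡ true → degreeIn G S a < degree G a
  degreeIn<degree S {a} {b} ¬sb ab = Unique-⊆⇒length≤ (b∉ ∷ filter⁺ InS? (allFin⁺ (n G))) ⊆neighbours
    where
    InS? : (y : Vertex G) → Dec (T (S y) × T (adj G a y))
    InS? y = T? (S y) ×-dec T? (adj G a y)
    b∉ : All (b ≢_) (filter InS? (allFin (n G)))
    b∉ = All.tabulate λ {y} y∈ b≡y → ¬sb (subst (T ∘ S) (sym b≡y) (proj₁ (∈-filter-allFin⁻ InS? y∈)))
    ⊆neighbours : b ∷ filter InS? (allFin (n G)) ⊆ filter (λ y → T? (adj G a y)) (allFin (n G))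
    ⊆neighbours (here refl) = ∈-filter-allFin⁺ (λ y → T? (adj G a y)) (Equivalence.from T-≡ ab)
    ⊆neighbours {y} (there y∈) =
      ∈-filter-allFin⁺ (λ y → T? (adj G a y)) (proj₂ (∈-filter-allFin⁻ InS? y∈))

  -- A proper subset has an edge leaving it, whose inner end loses a neighbour; the whole vertex set
  -- contains a vertex of degree below the maximum because G is not regular.
  connected-nonregular⇒degenerate : ∀ d → IsMaxDegree G (suc d) → Connected G → ¬ Regular G →
                                    Degenerate d G
  connected-nonregular⇒degenerate d (deg≤ , _) connected nonregular S (w , sw)
    with any? (λ y → ¬? (T? (S y)))
  ... | yes (y , ¬sy) with Path-exit {S} (connected w y) sw ¬sy
  ...   | a , b , sa , ¬sb , ab = a , sa , ≤-pred (<-≤-trans (degreeIn<degree S ¬sb ab) (deg≤ a))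
  connected-nonregular⇒degenerate d (deg≤ , _) connected nonregular S (w , sw) | no noneOutside
    with any? (λ u → degree G u <? suc d)
  ... | yes (u , deg<) = u , all∈S u , ≤-trans (degreeIn≤degree S u) (≤-pred deg<)
    where
    all∈S : ∀ u → T (S u)
    all∈S u = decidable-stable (T? (S u)) λ ¬su → noneOutside (u , ¬su)
  ... | no noneBelow = ⊥-elim (nonregular λ u v → trans (deg≡ u) (sym (deg≡ v)))
    where
    deg≡ : ∀ u → degree G u ≡ suc d
    deg≡ u = ≤-antisym (deg≤ u) (≮⇒≥ λ deg< → noneBelow (u , deg<))

  maxDegree-0⇒Regular : IsMaxDegree G 0 → Regular G
  maxDegree-0⇒Regular (deg≤ , _) u v = trans (n≤0⇒n≡0 (deg≤ u)) (sym (n≤0⇒n≡0 (deg≤ v)))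

  degreeIn≤precedingNbrs : (σ : Ordering G) → ∀ S {x} →
                           (∀ y → T (S y) → toℕ (pos σ y) ≤ toℕ (pos σ x)) →
                           degreeIn G S x ≤ precedingNbrs σ x
  degreeIn≤precedingNbrs σ S {x} x-last = Unique-⊆⇒length≤ (filter⁺ InS? (allFin⁺ (n G))) preceding
    where
    InS? : (y : Vertex G) → Dec (T (S y) × T (adj G x y))
    InS? y = T? (S y) ×-dec T? (adj G x y)
    Preceding? : (y : Vertex G) → Dec (T (adj G x y) × pos σ y <ᶠ pos σ x)
    Preceding? y = T? (adj G x y) ×-dec (pos σ y <ᶠ? pos σ x)
    preceding : filter InS? (allFin (n G)) ⊆ filter Preceding? (allFin (n G))
    preceding {y} y∈ with ∈-filter-allFin⁻ InS? y∈
    ... | sy , xy = ∈-filter-allFin⁺ Preceding?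
          (xy , ≤∧≢⇒< (x-last y sy) λ eq → y≢x (pos-injective σ (toℕ-injective eq)))
      where
      y≢x : y ≢ x
      y≢x refl = adj-irrefl (Equivalence.to T-≡ xy)

module ListColorings (G : Graph) (L : ListAssignment G) where

  open Subgraphs G

  Colored : Coloring G → ℕ → ℕ → Vertex G → Set
  Colored = ColoredIn {G}

  Colored-cong : ∀ {a b α β : ℕ} → a ≡ b → (a ≡ α) ⊎ (a ≡ β) → (b ≡ α) ⊎ (b ≡ β)
  Colored-cong refl c = c

  InListsOn : VertexSet → Coloring G → Set
  InListsOn S φ = ∀ v → T (S v) → φ v ∈ lists L v

  ProperOn : VertexSet → Coloring G → Set
  ProperOn S φ = ∀ u v → T (S u) → T (S v) → adj G u v ≡ true → φ u ≢ φ v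

  IsLColoringOn : VertexSet → Coloring G → Set
  IsLColoringOn S φ = InListsOn S φ × ProperOn S φ

  data ReachIn (S : VertexSet) (φ : Coloring G) (α β : ℕ) (u : Vertex G) : Vertex G → Set where
    here : T (S u) → Colored φ α β u → ReachIn S φ α β u u
    step : ∀ {v w} → ReachIn S φ α β u v → adj G v w ≡ true → T (S w) → Colored φ α β w →
           ReachIn S φ α β u w

  SwappedIn : VertexSet → ℕ → ℕ → Vertex G → Coloring G → Coloring G → Set
  SwappedIn S α β u φ ψ = ∀ w → T (S w) →
    (ReachIn S φ α β u w → ψ w ≡ swapColor α β (φ w)) × (¬ ReachIn S φ α β u w → ψ w ≡ φ w)

  KempeSwapIn : VertexSet → Coloring G → Coloring G → Set
  KempeSwapIn S φ ψ =
    ∃[ α ] ∃[ β ] Σ (Vertex G) λ u → T (S u) × Colored φ α β u × SwappedIn S α β u φ ψ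

  LValidSwapIn : VertexSet → Coloring G → Coloring G → Set
  LValidSwapIn S φ ψ = KempeSwapIn S φ ψ × IsLColoringOn S ψ

  AgreeOn : VertexSet → Coloring G → Coloring G → Set
  AgreeOn S φ ψ = ∀ w → T (S w) → φ w ≡ ψ w

  LSwappableOn : VertexSet → Set
  LSwappableOn S =
    Σ (Coloring G) (IsLColoringOn S) ×
    (∀ φ ψ → IsLColoringOn S φ → IsLColoringOn S ψ →
       Σ (Coloring G) λ χ → Star (LValidSwapIn S) φ χ × AgreeOn S χ ψ)

  LDegenerateOn : VertexSet → Set
  LDegenerateOn S =
    ∀ S' → S' ⊆ᵛ S → (∃[ w ] T (S' w)) → ∃[ w ] (T (S' w) × degreeIn G S' w < size L w)

  UsedAt : VertexSet → Coloring G → Vertex G → ℕ → Set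
  UsedAt S φ v c = ∃[ z ] (T (S z) × adj G v z ≡ true × φ z ≡ c)

  ReachIn-end : ∀ {S φ α β u w} → ReachIn S φ α β u w → T (S w) × Colored φ α β w
  ReachIn-end (here s c) = s , c
  ReachIn-end (step _ _ s c) = s , c

  ReachIn-cong : ∀ {S φ χ α β u w} → AgreeOn S φ χ → ReachIn S φ α β u w → ReachIn S χ α β u w
  ReachIn-cong eq (here s c) = here s (Colored-cong (eq _ s) c)
  ReachIn-cong eq (step r e s c) = step (ReachIn-cong eq r) e s (Colored-cong (eq _ s) c)

  ReachIn-mono : ∀ {S' S φ α β u w} → S' ⊆ᵛ S → ReachIn S' φ α β u w → ReachIn S φ α β u w
  ReachIn-mono S'⊆S (here s c) = here (S'⊆S _ s) c
  ReachIn-mono S'⊆S (step r e s c) = step (ReachIn-mono S'⊆S r) e (S'⊆S _ s) c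

  SwappedIn-cong : ∀ {S χ φ ψ α β u} → AgreeOn S χ φ → SwappedIn S α β u φ ψ → SwappedIn S α β u χ ψ
  SwappedIn-cong {α = α} {β} χ≈φ sw w s =
    (λ r → trans (proj₁ (sw w s) (ReachIn-cong χ≈φ r)) (cong (swapColor α β) (sym (χ≈φ w s)))) ,
    (λ ¬r → trans (proj₂ (sw w s) (¬r ∘ ReachIn-cong (λ x s → sym (χ≈φ x s)))) (sym (χ≈φ w s)))

  SwappedIn-idem : ∀ {S φ ψ α u} → SwappedIn S α α u φ ψ → AgreeOn S φ ψ
  SwappedIn-idem {φ = φ} {ψ} {α} sw w s = decidable-stable (φ w ≟ℕ ψ w) λ φw≢ψw →
    ¬¬-excluded-middle λ where
      (yes r) → φw≢ψw (sym (trans (proj₁ (sw w s) r) (swapColor-idem α (φ w))))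
      (no ¬r) → φw≢ψw (sym (proj₂ (sw w s) ¬r))

  -- y is not colored α or β, otherwise it would be reached, whereas ψ x is.
  boundary : ∀ {S φ ψ α β u x y} → SwappedIn S α β u φ ψ → T (S y) → adj G x y ≡ true →
             ReachIn S φ α β u x → ¬ ReachIn S φ α β u y → ψ x ≢ ψ y
  boundary {φ = φ} {ψ} {α} {β} {x = x} {y} sw sy xy rx ¬ry ψx≡ψy with (φ y ≟ℕ α) ⊎-dec (φ y ≟ℕ β)
  ... | yes cy = ¬ry (step rx xy sy cy)
  ... | no ¬cy = ¬cy (Colored-cong (sym φy≡ψx) (swapColor-stays (proj₂ (ReachIn-end rx))))
    where
    φy≡ψx : φ y ≡ swapColor α β (φ x)
    φy≡ψx = trans (sym (proj₂ (sw y sy) ¬ry))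
                  (trans (sym ψx≡ψy) (proj₁ (sw x (proj₁ (ReachIn-end rx))) rx))

  SwappedIn-proper : ∀ {S φ ψ α β u} → ProperOn S φ → SwappedIn S α β u φ ψ → ProperOn S ψ
  SwappedIn-proper {S} {φ} {ψ} {α} {β} {u} proper sw x y sx sy xy ψx≡ψy =
    ¬¬-excluded-middle λ dx → ¬¬-excluded-middle λ dy → both dx dy
    where
    both : Dec (ReachIn S φ α β u x) → Dec (ReachIn S φ α β u y) → ⊥
    both (yes rx) (yes ry) = proper x y sx sy xy (swapColor-injective α β
      (trans (sym (proj₁ (sw x sx) rx)) (trans ψx≡ψy (proj₁ (sw y sy) ry))))
    both (yes rx) (no ¬ry) = boundary sw sy xy rx ¬ry ψx≡ψy
    both (no ¬rx) (yes ry) = boundary sw sx (adj-sym xy) ry ¬rx (sym ψx≡ψy)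
    both (no ¬rx) (no ¬ry) = proper x y sx sy xy
      (trans (sym (proj₂ (sw x sx) ¬rx)) (trans ψx≡ψy (proj₂ (sw y sy) ¬ry)))

  updateAt-InListsOn : ∀ {S φ v c} → c ∈ lists L v → (∀ w → T (S w) → w ≢ v → φ w ∈ lists L w) →
                       InListsOn S (updateAt φ v (const c))
  updateAt-InListsOn {φ = φ} {v} c∈L inL w s with w ≟ᶠ v
  ... | yes refl = subst (_∈ lists L w) (sym (updateAt-updates w φ)) c∈L
  ... | no w≢v = subst (_∈ lists L w) (sym (updateAt-minimal w v φ w≢v)) (inL w s w≢v)

  recolor : ∀ {S φ v c} → IsLColoringOn S φ → T (S v) → c ∈ lists L v → ¬ UsedAt S φ v c →
            LValidSwapIn S φ (updateAt φ v (const c))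
  recolor {S} {φ} {v} {c} (inL , proper) sv c∈L free =
    (φ v , c , v , sv , inj₁ refl , swapped) ,
    updateAt-InListsOn c∈L (λ w s _ → inL w s) , SwappedIn-proper proper swapped
    where
    only-v : ∀ {w} → ReachIn S φ (φ v) c v w → w ≡ v
    only-v (here _ _) = refl
    only-v (step r vz sz cz) with only-v r
    ... | refl with cz
    ...   | inj₁ φz≡φv = ⊥-elim (proper _ _ sv sz vz (sym φz≡φv))
    ...   | inj₂ φz≡c = ⊥-elim (free (_ , sz , vz , φz≡c))
    swapped : SwappedIn S (φ v) c v φ (updateAt φ v (const c))
    swapped w s = inComponent , λ ¬r → updateAt-minimal w v φ λ { refl → ¬r (here sv (inj₁ refl)) }
      where
      inComponent : ReachIn S φ (φ v) c v w → updateAt φ v (const c) w ≡ swapColor (φ v) c (φ w)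
      inComponent r with only-v r
      ... | refl = trans (updateAt-updates v φ) (sym (swapColor-α (φ v) c))

  updateAt-ProperOn : ∀ {S φ v c} → ProperOn (S ─ v) φ → ¬ UsedAt S φ v c →
                      ProperOn S (updateAt φ v (const c))
  updateAt-ProperOn {S} {φ} {v} {c} proper free x y sx sy xy with x ≟ᶠ v | y ≟ᶠ v
  ... | yes refl | yes refl = ⊥-elim (adj-irrefl xy)
  ... | yes refl | no y≢v = λ eq → free (y , sy , xy ,
        trans (sym (updateAt-minimal y v φ y≢v)) (trans (sym eq) (updateAt-updates v φ)))
  ... | no x≢v | yes refl = λ eq → free (x , sx , adj-sym xy ,
        trans (sym (updateAt-minimal x v φ x≢v)) (trans eq (updateAt-updates v φ)))
  ... | no x≢v | no y≢v = λ eq → proper x y (─-intro S sx x≢v) (─-intro S sy y≢v) xy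
        (trans (sym (updateAt-minimal x v φ x≢v)) (trans eq (updateAt-minimal y v φ y≢v)))

  IsLColoringOn-mono : ∀ {S' S φ} → S' ⊆ᵛ S → IsLColoringOn S φ → IsLColoringOn S' φ
  IsLColoringOn-mono S'⊆S (inL , proper) =
    (λ w s → inL w (S'⊆S w s)) , (λ x y sx sy → proper x y (S'⊆S x sx) (S'⊆S y sy))

  module DeleteVertex (S : VertexSet) (v : Vertex G) (v∈S : T (S v)) (deg< : degreeIn G S v < size L v) where

    S' : VertexSet
    S' = S ─ v

    S'⊆S : S' ⊆ᵛ S
    S'⊆S = ─-⊆ S v

    Neighbour? : (z : Vertex G) → Dec (T (S z) × T (adj G v z))
    Neighbour? z = T? (S z) ×-dec T? (adj G v z)

    neighbours : List (Vertex G)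
    neighbours = filter Neighbour? (allFin (n G))

    ∈-neighbours : ∀ {z} → T (S z) → adj G v z ≡ true → z ∈ neighbours
    ∈-neighbours {z} sz vz = ∈-filter-allFin⁺ Neighbour? (sz , Equivalence.from T-≡ vz)

    usedAt? : ∀ χ c → Dec (UsedAt S χ v c)
    usedAt? χ c = any? λ z → T? (S z) ×-dec (adj G v z ≟ᵇ true) ×-dec (χ z ≟ℕ c)

    -- Pigeonhole: the colors of L(v) outside ex are carried by neighbours outside zs, and deg v < |L(v)|.
    fewerThanExcluded : ∀ χ (ex : List ℕ) {zs : List (Vertex G)} → Unique zs →
      (∀ {z} → z ∈ zs → T (S z) × adj G v z ≡ true × (χ z ∈ lists L v → χ z ∈ ex)) →
      (∀ {c} → c ∈ lists L v → c ∉ ex → UsedAt S χ v c) →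
      length zs < length ex
    fewerThanExcluded χ ex {zs} zs! zs-excluded used =
      +-cancelʳ-< (length others) (length zs) (length ex) (≤-<-trans lower (<-≤-trans deg< upper))
      where
      Other? : (z : Vertex G) → Dec ((T (S z) × T (adj G v z)) × χ z ∈ lists L v × χ z ∉ ex)
      Other? z = Neighbour? z ×-dec (χ z ∈? lists L v) ×-dec ¬? (χ z ∈? ex)
      others : List (Vertex G)
      others = filter Other? (allFin (n G))
      L⊆ : lists L v ⊆ ex ++ map χ others
      L⊆ {c} c∈L with c ∈? ex
      ... | yes c∈ex = ∈-++⁺ˡ c∈ex
      ... | no c∉ex with used c∈L c∉ex
      ...   | z , sz , vz , refl =
              ∈-++⁺ʳ ex (∈-map⁺ χ (∈-filter-allFin⁺ Other?
                ((sz , Equivalence.from T-≡ vz) , c∈L , c∉ex)))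
      upper : size L v ≤ length ex + length others
      upper = subst (size L v ≤_) (trans (length-++ ex) (cong (length ex +_) (length-map χ others)))
                (Unique-⊆⇒length≤ (unique L v) L⊆)
      disjoint : Disjoint zs others
      disjoint (z∈zs , z∈others) with zs-excluded z∈zs | ∈-filter-allFin⁻ Other? z∈others
      ... | _ , _ , excluded | _ , χz∈L , χz∉ex = χz∉ex (excluded χz∈L)
      ⊆neighbours : zs ++ others ⊆ neighbours
      ⊆neighbours {z} z∈ with ∈-++⁻ zs z∈
      ... | inj₁ z∈zs = let sz , vz , _ = zs-excluded z∈zs in ∈-neighbours sz vz
      ... | inj₂ z∈others =
              ∈-filter-allFin⁺ Neighbour? (proj₁ (∈-filter-allFin⁻ Other? z∈others))
      lower : length zs + length others ≤ degreeIn G S v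
      lower = subst (_≤ degreeIn G S v) (length-++ zs)
                (Unique-⊆⇒length≤ (++⁺ zs! (filter⁺ Other? (allFin⁺ (n G))) disjoint) ⊆neighbours)

    extend : ∀ {χ} → IsLColoringOn S' χ → Σ (Coloring G) (IsLColoringOn S)
    extend {χ} (inL , proper) with Any.any? (λ c → ¬? (usedAt? χ c)) (lists L v)
    ... | yes someFree = let c , c∈L , ¬used = find someFree in
          updateAt χ v (const c) ,
          updateAt-InListsOn c∈L (λ w s w≢v → inL w (─-intro S s w≢v)) ,
          updateAt-ProperOn proper ¬used
    ... | no noneFree = ⊥-elim (n≮n 0 (fewerThanExcluded χ [] [] (λ ())
            λ {c} c∈L _ → decidable-stable (usedAt? χ c) λ ¬used → noneFree (lose c∈L ¬used)))

    NotBridging : Coloring G → ℕ → ℕ → Vertex G → Set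
    NotBridging χ α β u = Colored χ α β v → ∀ {z z'} → T (S' z) → T (S' z') →
      adj G v z ≡ true → adj G v z' ≡ true → Colored χ α β z' →
      ReachIn S' χ α β u z → ReachIn S' χ α β u z'

    SwapAvailable : Coloring G → ℕ → ℕ → Set
    SwapAvailable χ α β = Colored χ α β v → ∀ {z} → T (S' z) → adj G v z ≡ true → Colored χ α β z →
      swapColor α β (χ v) ∈ lists L v

    ReachIn-split : ∀ {χ α β u w} → T (S' u) → NotBridging χ α β u → ReachIn S χ α β u w →
      ReachIn S' χ α β u w ⊎
      (w ≡ v × Colored χ α β v × ∃[ z ] (T (S' z) × adj G v z ≡ true × ReachIn S' χ α β u z))
    ReachIn-split su _ (here _ cu) = inj₁ (here su cu)
    ReachIn-split {w = w} su notBridging (step r yw sw cw) with ReachIn-split su notBridging r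
    ... | inj₂ (refl , cv , z , sz , vz , rz) =
          inj₁ (notBridging cv sz (─-intro S sw w≢v) vz yw cw rz)
      where
      w≢v : w ≢ v
      w≢v refl = adj-irrefl yw
    ... | inj₁ r' with w ≟ᶠ v
    ...   | yes refl = inj₂ (refl , cw , _ , proj₁ (ReachIn-end r') , adj-sym yw , r')
    ...   | no w≢v = inj₁ (step r' yw (─-intro S sw w≢v) cw)

    -- Rather than deciding reachability, the color of v is chosen by asking whether some
    -- α,β-colored neighbour of v actually changed color.
    module LiftSwap {χ φ' α β u} (α≢β : α ≢ β) (colχ : IsLColoringOn S χ) (inL' : InListsOn S' φ')
                    (su : T (S' u)) (swapped' : SwappedIn S' α β u χ φ') (notBridging : NotBridging χ α β u)
                    (available : SwapAvailable χ α β) where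

      Joins : Set
      Joins = Colored χ α β v ×
              ∃[ z ] (T (S' z) × adj G v z ≡ true × Colored χ α β z × φ' z ≢ χ z)

      joins? : Dec Joins
      joins? = ((χ v ≟ℕ α) ⊎-dec (χ v ≟ℕ β)) ×-dec any? λ z →
        T? (S' z) ×-dec (adj G v z ≟ᵇ true) ×-dec ((χ z ≟ℕ α) ⊎-dec (χ z ≟ℕ β)) ×-dec ¬? (φ' z ≟ℕ χ z)

      colorAtV : Dec Joins → ℕ
      colorAtV (yes _) = swapColor α β (χ v)
      colorAtV (no _) = χ v

      ψ : Coloring G
      ψ = updateAt φ' v (const (colorAtV joins?))

      ψ-outside : ∀ {w} → w ≢ v → ψ w ≡ φ' w
      ψ-outside {w} w≢v = updateAt-minimal w v φ' w≢v

      ψv-joins : Joins → ψ v ≡ swapColor α β (χ v)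
      ψv-joins j = trans (updateAt-updates v φ') (joining joins?)
        where
        joining : (j? : Dec Joins) → colorAtV j? ≡ swapColor α β (χ v)
        joining (yes _) = refl
        joining (no ¬j) = ⊥-elim (¬j j)

      ψv-stays : ¬ Joins → ψ v ≡ χ v
      ψv-stays ¬j = trans (updateAt-updates v φ') (staying joins?)
        where
        staying : (j? : Dec Joins) → colorAtV j? ≡ χ v
        staying (yes j) = ⊥-elim (¬j j)
        staying (no _) = refl

      moved : ∀ {z} → T (S' z) → ReachIn S' χ α β u z → φ' z ≢ χ z
      moved sz rz φ'z≡χz =
        swapColor-≢ α≢β (proj₂ (ReachIn-end rz)) (trans (sym (proj₁ (swapped' _ sz) rz)) φ'z≡χz)

      swapped-at-v : (ReachIn S χ α β u v → ψ v ≡ swapColor α β (χ v)) × (¬ ReachIn S χ α β u v → ψ v ≡ χ v)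
      swapped-at-v = reached , unreached
        where
        reached : ReachIn S χ α β u v → ψ v ≡ swapColor α β (χ v)
        reached r with ReachIn-split su notBridging r
        ... | inj₁ r' = ⊥-elim (─-≢ S (proj₁ (ReachIn-end r')) refl)
        ... | inj₂ (_ , cv , z , sz , vz , rz) =
              ψv-joins (cv , z , sz , vz , proj₂ (ReachIn-end rz) , moved sz rz)
        unreached : ¬ ReachIn S χ α β u v → ψ v ≡ χ v
        unreached ¬r = ψv-stays λ (cv , z , sz , vz , _ , φ'z≢χz) → φ'z≢χz (proj₂ (swapped' z sz)
          λ rz → ¬r (step (ReachIn-mono S'⊆S rz) (adj-sym vz) v∈S cv))

      swapped : SwappedIn S α β u χ ψ
      swapped w sw with w ≟ᶠ v
      ... | yes refl = swapped-at-v
      ... | no w≢v = reached , unreached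
        where
        reached : ReachIn S χ α β u w → ψ w ≡ swapColor α β (χ w)
        reached r with ReachIn-split su notBridging r
        ... | inj₁ r' = trans (ψ-outside w≢v) (proj₁ (swapped' w (─-intro S sw w≢v)) r')
        ... | inj₂ (w≡v , _) = ⊥-elim (w≢v w≡v)
        unreached : ¬ ReachIn S χ α β u w → ψ w ≡ χ w
        unreached ¬r =
          trans (ψ-outside w≢v) (proj₂ (swapped' w (─-intro S sw w≢v)) (¬r ∘ ReachIn-mono S'⊆S))

      inListsψ : InListsOn S ψ
      inListsψ = updateAt-InListsOn (colorAtV∈L joins?) λ w s w≢v → inL' w (─-intro S s w≢v)
        where
        colorAtV∈L : (j? : Dec Joins) → colorAtV j? ∈ lists L v
        colorAtV∈L (yes (cv , z , sz , vz , cz , _)) = available cv sz vz cz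
        colorAtV∈L (no _) = proj₁ colχ v v∈S

    liftSwap : ∀ {χ φ' α β u} → α ≢ β → IsLColoringOn S χ → InListsOn S' φ' →
      T (S' u) → Colored χ α β u →
      SwappedIn S' α β u χ φ' → NotBridging χ α β u → SwapAvailable χ α β →
      Σ (Coloring G) λ ψ → LValidSwapIn S χ ψ × AgreeOn S' ψ φ'
    liftSwap {φ' = φ'} {α} {β} {u} α≢β colχ inL' su cu swapped' notBridging available =
      ψ , ((α , β , u , S'⊆S u su , cu , swapped) , inListsψ , SwappedIn-proper (proj₂ colχ) swapped) ,
      λ w s → ψ-outside (─-≢ S s)
      where open LiftSwap α≢β colχ inL' su swapped' notBridging available

    UsedExcept : Coloring G → ℕ → ℕ → Set
    UsedExcept χ a b = ∀ {c} → c ∈ lists L v → c ≢ a → c ≢ b → UsedAt S χ v c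

    neighbours-colored-alike : ∀ {χ a b} → UsedExcept χ a b → ∀ {z z'} → T (S z) → T (S z') →
      adj G v z ≡ true → adj G v z' ≡ true → χ z ≡ b → χ z' ≡ b → z ≡ z'
    neighbours-colored-alike {χ} {a} {b} used {z} {z'} sz sz' vz vz' χz≡b χz'≡b with z ≟ᶠ z'
    ... | yes z≡z' = z≡z'
    ... | no z≢z' = ⊥-elim (n≮n 2 (fewerThanExcluded χ (a ∷ b ∷ []) {z ∷ z' ∷ []}
            ((z≢z' All.∷ All.[]) ∷ All.[] ∷ []) colored-b λ c∈L c∉ab →
            used c∈L (λ { refl → c∉ab (here refl) }) λ { refl → c∉ab (there (here refl)) }))
      where
      colored-b : ∀ {y} → y ∈ z ∷ z' ∷ [] →
                  T (S y) × adj G v y ≡ true × (χ y ∈ lists L v → χ y ∈ a ∷ b ∷ [])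
      colored-b (here refl) = sz , vz , λ _ → there (here χz≡b)
      colored-b (there (here refl)) = sz' , vz' , λ _ → there (here χz'≡b)

    neighbour-color∈L : ∀ {χ a b} → UsedExcept χ a b → ∀ {z} → T (S z) → adj G v z ≡ true → χ z ≡ b →
      b ∈ lists L v
    neighbour-color∈L {χ} {a} {b} used {z} sz vz χz≡b = decidable-stable (b ∈? lists L v) λ b∉L →
      n≮n 1 (fewerThanExcluded χ (a ∷ []) {z ∷ []} (All.[] ∷ [])
        (λ { (here refl) → sz , vz , λ χz∈L → ⊥-elim (b∉L (subst (_∈ lists L v) χz≡b χz∈L)) })
        λ c∈L c∉a → used c∈L (λ { refl → c∉a (here refl) }) λ { refl → b∉L c∈L })

    -- v carries a; the unique neighbour colored b is then v's only link to an α,β-component.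
    crowded-lift : ∀ {χ α β u a b} → ProperOn S χ → UsedExcept χ a b → χ v ≡ a → swapColor α β a ≡ b →
      (∀ {c} → (c ≡ α) ⊎ (c ≡ β) → c ≢ a → c ≡ b) → NotBridging χ α β u × SwapAvailable χ α β
    crowded-lift {χ} {α} {β} {u} {a} {b} proper used χv≡a swap≡b other-is-b = notBridging , available
      where
      colored-b : ∀ {z} → T (S' z) → adj G v z ≡ true → Colored χ α β z → χ z ≡ b
      colored-b sz vz cz = other-is-b cz λ χz≡a → proper v _ v∈S (S'⊆S _ sz) vz (trans χv≡a (sym χz≡a))
      notBridging : NotBridging χ α β u
      notBridging _ sz sz' vz vz' cz' rz = subst (ReachIn S' χ α β u)
        (neighbours-colored-alike used (S'⊆S _ sz) (S'⊆S _ sz') vz vz'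
          (colored-b sz vz (proj₂ (ReachIn-end rz))) (colored-b sz' vz' cz')) rz
      available : SwapAvailable χ α β
      available _ sz vz cz = subst (_∈ lists L v) (sym (trans (cong (swapColor α β) χv≡a) swap≡b))
        (neighbour-color∈L used (S'⊆S _ sz) vz (colored-b sz vz cz))

    LiftsTo : Coloring G → Coloring G → Set
    LiftsTo χ φ' =
      Σ (Coloring G) λ χ' → Star (LValidSwapIn S) χ χ' × IsLColoringOn S χ' × AgreeOn S' χ' φ'

    liftValidSwap : ∀ {χ φ φ'} → IsLColoringOn S χ → AgreeOn S' χ φ → LValidSwapIn S' φ φ' → LiftsTo χ φ'
    liftValidSwap {χ} {φ} {φ'} colχ@(inL , proper) χ≈φ ((α , β , u , su , cu , swapped) , (inL' , _))
      with α ≟ℕ β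
    ... | yes refl = χ , ε , colχ , λ w s → trans (χ≈φ w s) (SwappedIn-idem swapped w s)
    ... | no α≢β = byFreeColor (Any.any? FreeOther? (lists L v))
      where
      FreeOther? : (c : ℕ) → Dec (c ≢ α × c ≢ β × ¬ UsedAt S χ v c)
      FreeOther? c = ¬? (c ≟ℕ α) ×-dec ¬? (c ≟ℕ β) ×-dec ¬? (usedAt? χ c)
      cu-χ : Colored χ α β u
      cu-χ = Colored-cong (sym (χ≈φ u su)) cu
      viaFreeColor : ∃[ c ] (c ∈ lists L v × c ≢ α × c ≢ β × ¬ UsedAt S χ v c) → LiftsTo χ φ'
      viaFreeColor (c , c∈L , c≢α , c≢β , ¬used) =
        let χ₁ = updateAt χ v (const c)
            recolored = recolor colχ v∈S c∈L ¬used
            χ₁≈φ : AgreeOn S' χ₁ φ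
            χ₁≈φ w s = trans (updateAt-minimal w v χ (─-≢ S s)) (χ≈φ w s)
            notColored : ¬ Colored χ₁ α β v
            notColored cv = [ c≢α , c≢β ] (Colored-cong (updateAt-updates v χ) cv)
            ψ , lifted , ψ≈φ' = liftSwap α≢β (proj₂ recolored) inL' su (Colored-cong (sym (χ₁≈φ u su)) cu)
                                   (SwappedIn-cong χ₁≈φ swapped) (⊥-elim ∘ notColored) (⊥-elim ∘ notColored)
        in ψ , recolored ◅ lifted ◅ ε , proj₂ lifted , ψ≈φ'
      viaCrowded : NotBridging χ α β u × SwapAvailable χ α β → LiftsTo χ φ'
      viaCrowded (notBridging , available) =
        let ψ , lifted , ψ≈φ' =
              liftSwap α≢β colχ inL' su cu-χ (SwappedIn-cong χ≈φ swapped) notBridging available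
        in ψ , lifted ◅ ε , proj₂ lifted , ψ≈φ'
      byColorOfV : UsedExcept χ α β → Dec (χ v ≡ α) → Dec (χ v ≡ β) → LiftsTo χ φ'
      byColorOfV used (yes χv≡α) _ =
        viaCrowded (crowded-lift proper used χv≡α (swapColor-α α β)
          λ c∈αβ c≢α → [ ⊥-elim ∘ c≢α , id ] c∈αβ)
      byColorOfV used (no _) (yes χv≡β) =
        viaCrowded (crowded-lift proper (λ c∈L c≢β c≢α → used c∈L c≢α c≢β) χv≡β (swapColor-β α β)
          λ c∈αβ c≢β → [ id , ⊥-elim ∘ c≢β ] c∈αβ)
      byColorOfV used (no χv≢α) (no χv≢β) with used (inL v v∈S) χv≢α χv≢β
      ... | z , sz , vz , χz≡χv = ⊥-elim (proper v z v∈S sz vz (sym χz≡χv))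
      byFreeColor : Dec (Any.Any (λ c → c ≢ α × c ≢ β × ¬ UsedAt S χ v c) (lists L v)) → LiftsTo χ φ'
      byFreeColor (yes someFree) = viaFreeColor (find someFree)
      byFreeColor (no noneFree) = byColorOfV used (χ v ≟ℕ α) (χ v ≟ℕ β)
        where
        used : UsedExcept χ α β
        used {c} c∈L c≢α c≢β =
          decidable-stable (usedAt? χ c) λ ¬used → noneFree (lose c∈L (c≢α , c≢β , ¬used))

    liftSwaps : ∀ {φ φ'} → Star (LValidSwapIn S') φ φ' →
                ∀ {χ} → IsLColoringOn S χ → AgreeOn S' χ φ → LiftsTo χ φ'
    liftSwaps ε {χ} colχ χ≈φ = χ , ε , colχ , χ≈φ
    liftSwaps (swap ◅ swaps) colχ χ≈φ with liftValidSwap colχ χ≈φ swap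
    ... | χ₁ , steps₁ , colχ₁ , χ₁≈ with liftSwaps swaps colχ₁ χ₁≈
    ...   | χ₂ , steps₂ , colχ₂ , χ₂≈ = χ₂ , steps₁ ◅◅ steps₂ , colχ₂ , χ₂≈

    LSwappableOn-insert : LSwappableOn S' → LSwappableOn S
    LSwappableOn-insert ((φ₀ , colφ₀) , connected') = extend colφ₀ , connected
      where
      connected : ∀ φ ψ → IsLColoringOn S φ → IsLColoringOn S ψ →
                  Σ (Coloring G) λ χ → Star (LValidSwapIn S) φ χ × AgreeOn S χ ψ
      connected φ ψ colφ colψ@(inLψ , properψ)
        with connected' φ ψ (IsLColoringOn-mono S'⊆S colφ) (IsLColoringOn-mono S'⊆S colψ)
      ... | χ , swaps , χ≈ψ with liftSwaps swaps colφ (λ _ _ → refl)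
      ...   | θ , swaps′ , colθ , θ≈χ =
              updateAt θ v (const (ψ v)) , swaps′ ◅◅ (recolor colθ v∈S (inLψ v v∈S) ψv-free ◅ ε) , agrees
        where
        θ≈ψ : AgreeOn S' θ ψ
        θ≈ψ w s = trans (θ≈χ w s) (χ≈ψ w s)
        ψv-free : ¬ UsedAt S θ v (ψ v)
        ψv-free (z , sz , vz , θz≡ψv) = properψ v z v∈S sz vz
          (sym (trans (sym (θ≈ψ z (─-intro S sz λ { refl → adj-irrefl vz }))) θz≡ψv))
        agrees : AgreeOn S (updateAt θ v (const (ψ v))) ψ
        agrees w s with w ≟ᶠ v
        ... | yes refl = updateAt-updates w θ
        ... | no w≢v = trans (updateAt-minimal w v θ w≢v) (θ≈ψ w (─-intro S s w≢v))

  LSwappableOn-empty : ∀ {S} → ¬ (∃[ w ] T (S w)) → LSwappableOn S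
  LSwappableOn-empty empty =
    (const 0 , (λ w s → ⊥-elim (empty (w , s))) , λ x _ s _ _ → ⊥-elim (empty (x , s))) ,
    λ φ _ _ _ → φ , ε , λ w s → ⊥-elim (empty (w , s))

  LDegenerateOn-mono : ∀ {S' S} → S' ⊆ᵛ S → LDegenerateOn S → LDegenerateOn S'
  LDegenerateOn-mono S'⊆S degenerate S'' S''⊆S' = degenerate S'' λ w s → S'⊆S w (S''⊆S' w s)

  LDegenerateOn⇒LSwappableOn : ∀ S → Acc _<_ (length (members S)) → LDegenerateOn S → LSwappableOn S
  LDegenerateOn⇒LSwappableOn S (acc smaller) degenerate with any? (λ w → T? (S w))
  ... | no empty = LSwappableOn-empty empty
  ... | yes nonempty with degenerate S (λ _ s → s) nonempty
  ...   | v , v∈S , deg< = DeleteVertex.LSwappableOn-insert S v v∈S deg<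
          (LDegenerateOn⇒LSwappableOn (S ─ v) (smaller (─-members< v∈S))
            (LDegenerateOn-mono (─-⊆ S v) degenerate))

  everywhere : VertexSet
  everywhere _ = true

  ReachIn⇒Reach : ∀ {φ α β u w} → ReachIn everywhere φ α β u w → Reach {G} φ α β u w
  ReachIn⇒Reach (here _ cu) = here cu
  ReachIn⇒Reach (step r vw _ cw) = step (ReachIn⇒Reach r) vw cw

  Reach⇒ReachIn : ∀ {φ α β u w} → Reach {G} φ α β u w → ReachIn everywhere φ α β u w
  Reach⇒ReachIn (here cu) = here tt cu
  Reach⇒ReachIn (step r vw cw) = step (Reach⇒ReachIn r) vw tt cw

  IsLColoringOn⇒IsLColoring : ∀ {φ} → IsLColoringOn everywhere φ → IsLColoring L φ
  IsLColoringOn⇒IsLColoring (inL , proper) = (λ v → inL v tt) , λ u v → proper u v tt tt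

  IsLColoring⇒IsLColoringOn : ∀ {φ} → IsLColoring L φ → IsLColoringOn everywhere φ
  IsLColoring⇒IsLColoringOn (inL , proper) = (λ v _ → inL v) , λ u v _ _ → proper u v

  LValidSwapIn⇒LValidSwap : ∀ {φ ψ} → LValidSwapIn everywhere φ ψ → LValidSwap L φ ψ
  LValidSwapIn⇒LValidSwap ((α , β , u , _ , cu , swapped) , colψ) =
    (α , β , u , cu ,
     λ w → proj₁ (swapped w tt) ∘ Reach⇒ReachIn , λ ¬r → proj₂ (swapped w tt) (¬r ∘ ReachIn⇒Reach)) ,
    IsLColoringOn⇒IsLColoring colψ

  LDegenerate⇒LSwappable : LDegenerateOn everywhere → LSwappable G L
  LDegenerate⇒LSwappable degenerate with LDegenerateOn⇒LSwappableOn everywhere (<-wellFounded _) degenerate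
  ... | (φ₀ , colφ₀) , connected = (φ₀ , IsLColoringOn⇒IsLColoring colφ₀) , λ φ ψ colφ colψ →
        let χ , swaps , χ≈ψ =
              connected φ ψ (IsLColoring⇒IsLColoringOn colφ) (IsLColoring⇒IsLColoringOn colψ)
        in χ , Star.map LValidSwapIn⇒LValidSwap swaps , λ w → χ≈ψ w tt

  -- The last vertex of S' in the ordering has all its neighbours in S' before it.
  ordering⇒LDegenerate : (σ : Ordering G) → (∀ x → precedingNbrs σ x < size L x) →
                         LDegenerateOn everywhere
  ordering⇒LDegenerate σ few S' _ nonempty with maximum-exists (λ w → T? (S' w)) (pos σ) nonempty
  ... | x , sx , x-last = x , sx , ≤-<-trans (degreeIn≤precedingNbrs σ S' x-last) (few x)

  degenerate⇒LDegenerate : ∀ d → Degenerate d G → IsKAssignment (suc d) L → LDegenerateOn everywhere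
  degenerate⇒LDegenerate d degenerate k-assignment S' _ nonempty with degenerate S' nonempty
  ... | v , sv , deg≤d = v , sv , subst (degreeIn G S' v <_) (sym (k-assignment v)) (s≤s deg≤d)

  maxDegree⇒LDegenerate : ∀ Δ → IsMaxDegree G Δ → Connected G → ¬ Regular G → IsKAssignment Δ L →
                          LDegenerateOn everywhere
  maxDegree⇒LDegenerate zero maxDeg _ nonregular _ = ⊥-elim (nonregular (maxDegree-0⇒Regular maxDeg))
  maxDegree⇒LDegenerate (suc d) maxDeg connected nonregular =
    degenerate⇒LDegenerate d (connected-nonregular⇒degenerate d maxDeg connected nonregular)

corollary2 : ((G : Graph) (L : ListAssignment G) (σ : Ordering G) →
    (∀ x → precedingNbrs σ x < size L x) → LSwappable G L)
    ×
    ((G : Graph) (L : ListAssignment G) (d : ℕ) →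
    Degenerate d G → IsKAssignment (suc d) L → LSwappable G L)
    ×
    ((G : Graph) (L : ListAssignment G) (Δ : ℕ) →
    IsMaxDegree G Δ → Connected G → ¬ Regular G →
    IsKAssignment Δ L → LSwappable G L)
corollary2 =
  (λ G L σ few → LDegenerate⇒LSwappable G L (ordering⇒LDegenerate G L σ few)) ,
  (λ G L d degenerate k → LDegenerate⇒LSwappable G L (degenerate⇒LDegenerate G L d degenerate k)) ,
  (λ G L Δ maxDeg connected nonregular k →
    LDegenerate⇒LSwappable G L (maxDegree⇒LDegenerate G L Δ maxDeg connected nonregular k))
  where open ListColorings
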